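{- Let $(Q,\mathcal S)$ be a hypergraph with $Q=\{q_1,\dots,q_m\}$ and $\mathcal S=\{S_1,\dots,S_n\}$, where $n\ge 2$, each $S_j\neq\emptyset$, and $S_n=Q$. Let $G$ be the graph constructed from $(Q,\mathcal S)$ as described in the context. Then $(Q,\mathcal S)$ has a $2$-colouring if and only if $G$ contains $P_5$ as a contraction.
   Context: A $2$-colouring of a hypergraph $(Q,\mathcal S)$ is a partition $(Q_1,Q_2)$ of $Q$ such that $Q_1\cap S\neq\emptyset$ and $Q_2\cap S\neq\emptyset$ for every $S\in\mathcal S$. $P_5$ is the path on $5$ vertices. Contracting an edge $uv$ means deleting $u,v$ and adding a new vertex adjacent to $(N(u)\cup N(v))\setminus\{u,v\}$ (no multiple edges or loops); $G$ contains $H$ as a contraction if $H$ can be obtained from $G$ by a sequence of edge contractions. The graph $G$ is constructed as follows. Its vertex set consists of: the vertices $q_1,\dots,q_m$; vertices $S_1,\dots,S_n$; vertices $S_1',\dots,S_n'$; for every pair $(i,j)$ with $q_i\in S_j$ a vertex $q^i_j$ (the set of these is $Q'$); and five further vertices $q^*,u_1,u_2,v,w$. Its edges are: $q_iS_j'$ whenever $q_i\in S_j$; $S_jS_k'$ for all $j,k\in\{1,\dots,n\}$; $q^i_jq_i$ and $q^i_jS_j$ for every $q^i_j\in Q'$ (there is no edge $q_iS_j$); $q^*u_1$, $q^*u_2$; $q^*q^i_j$ for every $q^i_j\in Q'$; $u_1S_j$ and $u_2S_j$ for every $j$; $u_1v$, $u_2v$; and $wS_j'$ for every $j$. There are no other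 edges. -}

module Defs where

open import Data.Bool using (Bool; true; false; T; not)
open import Data.Bool.Properties using (T-irrelevant)
open import Data.Empty using (⊥)
open import Data.Unit using (⊤; tt)
open import Data.Nat using (ℕ; zero; suc)
open import Data.Fin as Fin using (Fin; toℕ; fromℕ)
open import Data.Fin.Subset as Sub using (Subset; _∈_; Nonempty)
open import Data.Fin.Subset.Properties using (_∈?_)
open import Data.Maybe using (Maybe; just; nothing)
import Data.Maybe.Properties as MaybeP
open import Data.Product using (Σ; _×_; _,_; ∃)
import Data.Product.Properties as ProdP
open import Data.Sum using (_⊎_; inj₁; inj₂)
import Data.Sum.Properties as SumP
open import Relation.Nullary using (Dec; yes; no; ¬_)
open import Relation.Nullary.Decidable using (True; False; isYes)
open import Relation.Binary.Definitions using (DecidableEquality)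
open import Relation.Binary.PropositionalEquality using (_≡_; refl)
open import Function.Bundles using (_↔_; Inverse; _⇔_)

record Graph : Set₁ where
  field
    V   : Set
    _≟V_ : DecidableEquality V
    E   : V → V → Set
open Graph public

T-≟ : ∀ {b} → DecidableEquality (T b)
T-≟ x y = yes (T-irrelevant x y)

-- Contraction of the edge uv: delete u and v, add a new vertex ("nothing")
-- adjacent to (N(u) ∪ N(v)) \ {u,v}.  Old vertices other than u, v are
-- "just (x , _)".
module _ (G : Graph) (u v : V G) where
  CV : Set
  CV = Maybe (Σ (V G) λ x → False ((_≟V_ G) x u) × False ((_≟V_ G) x v))

  CV-≟ : DecidableEquality CV
  CV-≟ = MaybeP.≡-dec (ProdP.≡-dec (_≟V_ G)
           (ProdP.≡-dec T-≟ T-≟))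

  CE : CV → CV → Set
  CE nothing  nothing  = ⊥
  CE nothing  (just (y , _)) = E G u y ⊎ E G v y
  CE (just (x , _)) nothing  = E G x u ⊎ E G x v
  CE (just (x , _)) (just (y , _)) = E G x y

contract : (G : Graph) (u v : V G) → E G u v → Graph
contract G u v _ = record { V = CV G u v ; _≟V_ = CV-≟ G u v ; E = CE G u v }

record _≅_ (G H : Graph) : Set₁ where
  field
    bij  : V G ↔ V H
    adj  : ∀ x y → E G x y ⇔ E H (Inverse.to bij x) (Inverse.to bij y)

data ContainsContraction : Graph → Graph → Set₂ where
  done : ∀ {G H} → G ≅ H → ContainsContraction G H
  step : ∀ {G H} (u v : V G) (e : E G u v) →
         ContainsContraction (contract G u v e) H → ContainsContraction G H

P5 : Graph
P5 = record
  { V = Fin 5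
  ; _≟V_ = Fin._≟_
  ; E = λ i j → toℕ j ≡ suc (toℕ i) ⊎ toℕ i ≡ suc (toℕ j)
  }

-- Hypergraphs: Q = {q_0,…,q_{m-1}} is Fin m, 𝒮 = (S_0,…,S_{n-1}) a family
-- of subsets of Q indexed by Fin n.

Hypergraph : ℕ → ℕ → Set
Hypergraph m n = Fin n → Subset m

-- A 2-colouring: a partition (Q₁,Q₂) of Q, given by c : Q → Bool
-- (Q₁ = c⁻¹ true, Q₂ = c⁻¹ false), meeting both parts in every S.
Is2Colouring : ∀ {m n} → Hypergraph m n → (Fin m → Bool) → Set
Is2Colouring {m} {n} S c =
  (j : Fin n) → (∃ λ i → i ∈ S j × c i ≡ true) × (∃ λ i → i ∈ S j × c i ≡ false)

Has2Colouring : ∀ {m n} → Hypergraph m n → Set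
Has2Colouring {m} S = ∃ λ (c : Fin m → Bool) → Is2Colouring S c

Q' : ∀ {m n} → Hypergraph m n → Set
Q' {m} {n} S = Σ (Fin m × Fin n) λ { (i , j) → True (i ∈? S j) }

GV : ∀ {m n} → Hypergraph m n → Set
GV {m} {n} S = Fin m ⊎ Fin n ⊎ Fin n ⊎ Q' S ⊎ Fin 5

pattern vq i      = inj₁ i
pattern vS j      = inj₂ (inj₁ j)
pattern vS' j     = inj₂ (inj₂ (inj₁ j))
pattern vQ' i j p = inj₂ (inj₂ (inj₂ (inj₁ ((i , j) , p))))
pattern vq*       = inj₂ (inj₂ (inj₂ (inj₂ Fin.zero)))
pattern vu₁       = inj₂ (inj₂ (inj₂ (inj₂ (Fin.suc Fin.zero))))
pattern vu₂       = inj₂ (inj₂ (inj₂ (inj₂ (Fin.suc (Fin.suc Fin.zero)))))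
pattern vv        = inj₂ (inj₂ (inj₂ (inj₂ (Fin.suc (Fin.suc (Fin.suc Fin.zero))))))
pattern vw        = inj₂ (inj₂ (inj₂ (inj₂ (Fin.suc (Fin.suc (Fin.suc (Fin.suc Fin.zero)))))))

GV-≟ : ∀ {m n} (S : Hypergraph m n) → DecidableEquality (GV S)
GV-≟ S = SumP.≡-dec Fin._≟_ (SumP.≡-dec Fin._≟_ (SumP.≡-dec Fin._≟_
           (SumP.≡-dec (ProdP.≡-dec (ProdP.≡-dec Fin._≟_ Fin._≟_) T-≟) Fin._≟_)))

-- one orientation of each edge
GB : ∀ {m n} (S : Hypergraph m n) → GV S → GV S → Set
GB S (vq i)      (vS' j)  = i ∈ S j
GB S (vS j)      (vS' k)  = ⊤
GB S (vQ' i j _) (vq i')  = i ≡ i'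
GB S (vQ' i j _) (vS j')  = j ≡ j'
GB S vq*         vu₁      = ⊤
GB S vq*         vu₂      = ⊤
GB S vq*         (vQ' _ _ _) = ⊤
GB S vu₁         (vS j)   = ⊤
GB S vu₂         (vS j)   = ⊤
GB S vu₁         vv       = ⊤
GB S vu₂         vv       = ⊤
GB S vw          (vS' j)  = ⊤
GB S _           _        = ⊥

GE : ∀ {m n} (S : Hypergraph m n) → GV S → GV S → Set
GE S x y = GB S x y ⊎ GB S y x

graphG : ∀ {m n} → Hypergraph m n → Graph
graphG S = record { V = GV S ; _≟V_ = GV-≟ S ; E = GE S }

module Submission where

-- The proof goes through models: a model of H in G is a surjection
-- φ : V(G) → V(H) with connected fibres mapping each edge to an edge or a
-- single vertex of H.  For finite loopless G and loopless H, a model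
-- realising every edge of H yields a contraction (contract edges inside
-- fibres until φ is injective); conversely, a contraction of a symmetric G
-- onto H pulls back to a model.
--
-- A model of P₅ gives a levelling: a 1-Lipschitz map onto {0,…,4} with
-- connected level sets.  For our G:
--   ⇒  a 2-colouring (Q₁,Q₂) gives the model v ↦ 0, {q*,u₁,u₂} ↦ 1,
--      Q₂ ∪ {Sⱼ} ∪ Q′ ↦ 2, Q₁ ∪ {S′ⱼ} ↦ 3, w ↦ 4;
--   ⇐  levels 0 and 4 lie at distance 4, and the distance table of G leaves
--      only the pairs v–w, v–qᵢ, q*–w (after possibly reading the levelling
--      upside down).  The last two contradict connectivity of level 1; for
--      v–w the levels are forced as above, and the level-3 and level-2
--      elements of Q each meet every Sⱼ, giving the colouring.

open import Defs
open import Data.Bool using (Bool; true; false; T)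
open import Data.Bool.Properties using (T-irrelevant)
open import Data.Empty using (⊥; ⊥-elim)
open import Data.Unit using (tt)
open import Data.Nat using (ℕ; zero; suc; _≤_; _+_; _∸_; s≤s; z≤n; s≤s⁻¹; _≟_)
open import Data.Nat.Properties using (suc-injective; 1+n≢n; n≤1+n; m≤n⇒m≤1+n; ≤-reflexive; ≤-trans; ≤-antisym; m≤n+m; +-suc; +-monoˡ-≤; +-monoʳ-≤; m≤n+m∸n; m≤n+o⇒m∸n≤o; m∸n≤m; ∸-cancelˡ-≡; module ≤-Reasoning)
open import Data.Fin as F using (Fin; toℕ; inject₁; fromℕ; #_)
open import Data.Fin.Properties using (toℕ-injective; toℕ-inject₁; toℕ<n)
open import Data.Fin.Subset using (Nonempty; ⊤) renaming (_∈_ to _∈ₛ_)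
open import Data.Fin.Subset.Properties using (∈⊤; _∈?_)
open import Data.List using (List; []; _∷_; length; map; _++_; concatMap; allFin)
open import Data.List.Properties using (length-removeAt′; length-map)
open import Data.List.Membership.Propositional using (_∈_; lose)
open import Data.List.Membership.Propositional.Properties using (∈-map⁺; ∈-++⁺ˡ; ∈-++⁺ʳ; ∈-concatMap⁺; ∈-allFin)
open import Data.List.Relation.Unary.Any using (here; there; any?; satisfied; _─_)
open import Data.Maybe using (just; nothing)
open import Data.Product using (Σ; _×_; _,_; proj₁; proj₂)
open import Data.Sum using (_⊎_; inj₁; inj₂; swap) renaming (map to ⊎-map)
open import Function using (_∘_)
open import Function.Bundles using (_↔_; Inverse; _⇔_; mk⇔; mk↔; Equivalence)
open import Relation.Nullary using (Dec; yes; no; ¬_)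
open import Relation.Nullary.Decidable using (fromWitness; toWitness; isYes; fromWitnessFalse; toWitnessFalse; ¬?; _×-dec_)
open import Relation.Unary using (Decidable)
open import Relation.Binary.Definitions using (DecidableEquality)
open import Relation.Binary.PropositionalEquality using (_≡_; _≢_; refl; sym; trans; cong; subst; subst₂)

Symmetric : Graph → Set
Symmetric G = ∀ x y → E G x y → E G y x

Irreflexive : Graph → Set
Irreflexive G = ∀ x → ¬ E G x x

-- A walk from x to y all of whose vertices after x satisfy P.
infixr 5 _∷_
data Walk (G : Graph) (P : V G → Set) : V G → V G → Set where
  []  : ∀ {x} → Walk G P x x
  _∷_ : ∀ {x y z} → E G x y × P y → Walk G P y z → Walk G P x z

module _ {G : Graph} where

  mapWalk : ∀ {P Q : V G → Set} → (∀ {z} → P z → Q z) →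
            ∀ {x y} → Walk G P x y → Walk G Q x y
  mapWalk f [] = []
  mapWalk f ((e , p) ∷ w) = (e , f p) ∷ mapWalk f w

  _++ʷ_ : ∀ {P x y z} → Walk G P x y → Walk G P y z → Walk G P x z
  [] ++ʷ w′ = w′
  (s ∷ w) ++ʷ w′ = s ∷ (w ++ʷ w′)

  reverseʷ : Symmetric G → ∀ {P x y} → P x → Walk G P x y → Walk G P y x
  reverseʷ symG px [] = []
  reverseʷ symG {x = x} px (_∷_ {y = y} (e , py) w) =
    reverseʷ symG py w ++ʷ ((symG x y e , px) ∷ [])

  exit : ∀ {P T : V G → Set} → Decidable T → ∀ {x y} → Walk G P x y →
         T x → ¬ T y → Σ (V G) λ a → Σ (V G) λ b → T a × ¬ T b × E G a b × P b
  exit T? [] tx ¬ty = ⊥-elim (¬ty tx)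
  exit T? {x} (_∷_ {y = y} (e , py) w) tx ¬ty with T? y
  ... | yes ty = exit T? w ty ¬ty
  ... | no ¬ty′ = x , y , tx , ¬ty′ , e , py

  leave : ∀ {P x y} → Walk G P x y → x ≢ y →
          Σ (V G) λ z → E G x z × P z × z ≢ x
  leave {x = x} w x≢y with exit (λ z → (_≟V_ G) z x) w refl (x≢y ∘ sym)
  ... | a , b , refl , b≢a , e , pb = b , e , pb , b≢a

record Enumeration (A : Set) : Set where
  field
    elements : List A
    complete : ∀ x → x ∈ elements
open Enumeration

enum-Fin : ∀ n → Enumeration (Fin n)
enum-Fin n = record { elements = allFin n ; complete = ∈-allFin }

enum-T : ∀ b → Enumeration (T b)
enum-T true  = record { elements = tt ∷ [] ; complete = λ { tt → here refl } }
enum-T false = record { elements = [] ; complete = λ () }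

enum-⊎ : ∀ {A B} → Enumeration A → Enumeration B → Enumeration (A ⊎ B)
enum-⊎ EA EB = record
  { elements = map inj₁ (elements EA) ++ map inj₂ (elements EB)
  ; complete = λ { (inj₁ a) → ∈-++⁺ˡ (∈-map⁺ inj₁ (complete EA a))
                 ; (inj₂ b) → ∈-++⁺ʳ _ (∈-map⁺ inj₂ (complete EB b)) } }

enum-Σ : ∀ {A : Set} {B : A → Set} → Enumeration A → (∀ a → Enumeration (B a)) →
         Enumeration (Σ A B)
enum-Σ {A} {B} EA EB = record
  { elements = concatMap fibre (elements EA)
  ; complete = λ { (a , b) → ∈-concatMap⁺ fibre (lose (complete EA a)
                                 (∈-map⁺ (a ,_) (complete (EB a) b))) } }
  where
  fibre : A → List (Σ A B)
  fibre a = map (a ,_) (elements (EB a))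

collision-or-injective : ∀ {A B : Set} → DecidableEquality A → DecidableEquality B →
  Enumeration A → (f : A → B) →
  (Σ A λ x → Σ A λ y → x ≢ y × f x ≡ f y) ⊎ (∀ x y → f x ≡ f y → x ≡ y)
collision-or-injective _≟A_ _≟B_ EA f
  with any? (λ x → any? (λ y → ¬? (x ≟A y) ×-dec (f x ≟B f y)) xs) xs
  where xs = elements EA
... | yes p with satisfied p
...   | x , q with satisfied q
...     | y , x≢y , fx≡fy = inj₁ (x , y , x≢y , fx≡fy)
collision-or-injective _≟A_ _≟B_ EA f | no ¬p = inj₂ injective
  where
  injective : ∀ x y → f x ≡ f y → x ≡ y
  injective x y fx≡fy with x ≟A y
  ... | yes x≡y = x≡y
  ... | no x≢y = ⊥-elim (¬p (lose (complete EA x) (lose (complete EA y) (x≢y , fx≡fy))))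

∈-─ : ∀ {A : Set} {x y : A} {xs} → y ∈ xs → (p : x ∈ xs) → y ≢ x → y ∈ (xs ─ p)
∈-─ (here refl) (here refl) y≢x = ⊥-elim (y≢x refl)
∈-─ (here refl) (there p)   y≢x = here refl
∈-─ (there q)   (here refl) y≢x = q
∈-─ (there q)   (there p)   y≢x = there (∈-─ q p y≢x)

module Quotient (G : Graph) (u v : V G) where

  private
    _≟G_ = _≟V_ G

  π : V G → CV G u v
  π x with x ≟G u | x ≟G v
  ... | yes _ | _     = nothing
  ... | no _  | yes _ = nothing
  ... | no p  | no q  = just (x , fromWitnessFalse p , fromWitnessFalse q)

  data View (x : V G) : CV G u v → Set where
    at-u  : x ≡ u → View x nothing
    at-v  : x ≡ v → View x nothing
    other : ∀ p q → View x (just (x , p , q))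

  view : ∀ x → View x (π x)
  view x with x ≟G u | x ≟G v
  ... | yes x≡u | _     = at-u x≡u
  ... | no _  | yes x≡v = at-v x≡v
  ... | no _  | no _    = other _ _

  π-u : π u ≡ nothing
  π-u with π u | view u
  ... | nothing | _         = refl
  ... | just _  | other p _ = ⊥-elim (toWitnessFalse p refl)

  π-v : π v ≡ nothing
  π-v with π v | view v
  ... | nothing | _         = refl
  ... | just _  | other _ q = ⊥-elim (toWitnessFalse q refl)

  π-other : ∀ x p q → π x ≡ just (x , p , q)
  π-other x p q with π x | view x
  ... | nothing | at-u x≡u = ⊥-elim (toWitnessFalse p x≡u)
  ... | nothing | at-v x≡v = ⊥-elim (toWitnessFalse q x≡v)
  ... | just _  | other p′ q′ rewrite T-irrelevant p p′ | T-irrelevant q q′ = refl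

  π-onto : ∀ X → Σ (V G) λ x → π x ≡ X
  π-onto nothing = u , π-u
  π-onto (just (x , p , q)) = x , π-other x p q

  π-edge : ∀ {x y} → E G x y → π x ≡ π y ⊎ CE G u v (π x) (π y)
  π-edge {x} {y} e with π x | view x | π y | view y
  ... | nothing | _         | nothing | _         = inj₁ refl
  ... | nothing | at-u refl | just _  | other _ _ = inj₂ (inj₁ e)
  ... | nothing | at-v refl | just _  | other _ _ = inj₂ (inj₂ e)
  ... | just _  | other _ _ | nothing | at-u refl = inj₂ (inj₁ e)
  ... | just _  | other _ _ | nothing | at-v refl = inj₂ (inj₂ e)
  ... | just _  | other _ _ | just _  | other _ _ = inj₂ e

  shrink : u ≢ v → (xs : List (V G)) → (∀ x → x ∈ xs) →
           Σ (List (CV G u v)) λ ys → (∀ X → X ∈ ys) × suc (length ys) ≡ length xs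
  shrink u≢v xs complete =
    map π (xs ─ u∈xs) , covered , trans (cong suc (length-map π (xs ─ u∈xs))) (sym (length-removeAt′ xs _))
    where
    u∈xs = complete u
    covered : ∀ X → X ∈ map π (xs ─ u∈xs)
    covered X with π-onto X
    ... | x , refl = image (x ≟G u)
      where
      image : Dec (x ≡ u) → π x ∈ map π (xs ─ u∈xs)
      image (no x≢u) = ∈-map⁺ π (∈-─ (complete x) u∈xs x≢u)
      image (yes refl) = subst (_∈ map π (xs ─ u∈xs)) (trans π-v (sym π-u))
                           (∈-map⁺ π (∈-─ (complete v) u∈xs (u≢v ∘ sym)))

contract-symmetric : ∀ G u v (e : E G u v) → Symmetric G → Symmetric (contract G u v e)
contract-symmetric G u v e symG nothing (just _) (inj₁ c) = inj₁ (symG _ _ c)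
contract-symmetric G u v e symG nothing (just _) (inj₂ c) = inj₂ (symG _ _ c)
contract-symmetric G u v e symG (just _) nothing (inj₁ c) = inj₁ (symG _ _ c)
contract-symmetric G u v e symG (just _) nothing (inj₂ c) = inj₂ (symG _ _ c)
contract-symmetric G u v e symG (just _) (just _) c = symG _ _ c

record Model (G H : Graph) : Set where
  field
    φ         : V G → V H
    onto      : ∀ h → Σ (V G) λ x → φ x ≡ h
    respects  : ∀ x y → E G x y → φ x ≡ φ y ⊎ E H (φ x) (φ y)
    connected : ∀ x y → φ x ≡ φ y → Walk G (λ z → φ z ≡ φ x) x y

Realising : ∀ {G H} → Model G H → Set
Realising {G} {H} M = ∀ h h′ → E H h h′ →
  Σ (V G) λ a → Σ (V G) λ b → φ a ≡ h × φ b ≡ h′ × E G a b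
  where open Model M

iso-model : ∀ {G H} → G ≅ H → Model G H
iso-model {G} {H} iso = record
  { φ = to ; onto = λ h → from h , inverseˡ refl ; respects = respects ; connected = connected }
  where
  open _≅_ iso
  open Inverse bij
  respects : ∀ x y → E G x y → to x ≡ to y ⊎ E H (to x) (to y)
  respects x y e = inj₂ (Equivalence.to (adj x y) e)
  connected : ∀ x y → to x ≡ to y → Walk G (λ z → to z ≡ to x) x y
  connected x y tx≡ty with trans (sym (inverseʳ refl)) (inverseʳ tx≡ty)
  ... | refl = []

module Lifted {G H : Graph} (symG : Symmetric G) {u v : V G} (e : E G u v)
              (M′ : Model (contract G u v e) H) where
  open Quotient G u v
  open Model M′ renaming (φ to φ′; onto to onto′; respects to respects′; connected to connected′)

  φ : V G → V H
  φ = φ′ ∘ π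

  same-class : ∀ x y → π x ≡ π y → x ≡ y ⊎ E G x y
  same-class x y eq with π x | view x | π y | view y
  same-class x y refl | nothing | at-u refl | nothing | at-u refl = inj₁ refl
  same-class x y refl | nothing | at-u refl | nothing | at-v refl = inj₂ e
  same-class x y refl | nothing | at-v refl | nothing | at-u refl = inj₂ (symG _ _ e)
  same-class x y refl | nothing | at-v refl | nothing | at-v refl = inj₁ refl
  same-class x y refl | just _  | other _ _ | just _  | other _ _ = inj₁ refl

  Hop : V G → CV G u v → Set
  Hop x Y = Σ (V G) λ y → π y ≡ Y ×
            (E G x y ⊎ Σ (V G) λ z → E G x z × E G z y × π z ≡ π x)

  hop : ∀ x Y → CE G u v (π x) Y → Hop x Y
  hop x Y ce with π x | view x
  hop x nothing (inj₁ c) | just _ | other _ _ = u , π-u , inj₁ c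
  hop x nothing (inj₂ c) | just _ | other _ _ = v , π-v , inj₁ c
  hop x (just (y , p , q)) c | just _ | other _ _ = y , π-other y p q , inj₁ c
  hop x (just (y , p , q)) (inj₁ c) | nothing | at-u refl = y , π-other y p q , inj₁ c
  hop x (just (y , p , q)) (inj₂ c) | nothing | at-u refl = y , π-other y p q , inj₂ (v , e , c , π-v)
  hop x (just (y , p , q)) (inj₁ c) | nothing | at-v refl = y , π-other y p q , inj₂ (u , symG _ _ e , c , π-u)
  hop x (just (y , p , q)) (inj₂ c) | nothing | at-v refl = y , π-other y p q , inj₁ c

  lift : ∀ {h X Y} → Walk (contract G u v e) (λ Z → φ′ Z ≡ h) X Y →
         ∀ x y → π x ≡ X → π y ≡ Y → φ x ≡ h → Walk G (λ z → φ z ≡ h) x y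
  lift [] x y refl πy≡πx φx≡h with same-class x y (sym πy≡πx)
  ... | inj₁ refl = []
  ... | inj₂ exy = (exy , trans (cong φ′ πy≡πx) φx≡h) ∷ []
  lift (_∷_ {y = Z} (ce , p) w) x y refl πy≡Y φx≡h with hop x Z ce
  ... | z , πz≡Z , inj₁ exz = (exz , φz≡h) ∷ lift w z y πz≡Z πy≡Y φz≡h
    where φz≡h = trans (cong φ′ πz≡Z) p
  ... | z , πz≡Z , inj₂ (m , exm , emz , πm≡πx) =
        (exm , trans (cong φ′ πm≡πx) φx≡h) ∷ ((emz , φz≡h) ∷ lift w z y πz≡Z πy≡Y φz≡h)
    where φz≡h = trans (cong φ′ πz≡Z) p

  model : Model G H
  model = record { φ = φ ; onto = onto ; respects = respects ; connected = connected }
    where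
    onto : ∀ h → Σ (V G) λ x → φ x ≡ h
    onto h with onto′ h
    ... | X , φ′X≡h with π-onto X
    ...   | x , refl = x , φ′X≡h
    respects : ∀ x y → E G x y → φ x ≡ φ y ⊎ E H (φ x) (φ y)
    respects x y exy with π-edge exy
    ... | inj₁ πx≡πy = inj₁ (cong φ′ πx≡πy)
    ... | inj₂ ce = respects′ (π x) (π y) ce
    connected : ∀ x y → φ x ≡ φ y → Walk G (λ z → φ z ≡ φ x) x y
    connected x y φx≡φy = lift (connected′ (π x) (π y) φx≡φy) x y refl refl refl

contraction-model : ∀ {G H} → Symmetric G → ContainsContraction G H → Model G H
contraction-model symG (done iso) = iso-model iso
contraction-model {G} symG (step u v e c) =
  Lifted.model symG e
    (contraction-model (contract-symmetric G u v e symG) c)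

injective-model-iso : ∀ {G H} → Irreflexive G → (M : Model G H) → Realising M →
  (∀ x y → Model.φ M x ≡ Model.φ M y → x ≡ y) → G ≅ H
injective-model-iso {G} {H} irrG M realising injective = record { bij = bij ; adj = adj }
  where
  open Model M
  bij : V G ↔ V H
  bij = mk↔ {to = φ} {from = proj₁ ∘ onto}
    ( (λ {h} {x} x≡ → trans (cong φ x≡) (proj₂ (onto h)))
    , (λ {x} {h} h≡φx → injective _ _ (trans (proj₂ (onto h)) h≡φx)) )
  adj : ∀ x y → E G x y ⇔ E H (φ x) (φ y)
  adj x y = mk⇔ forth back
    where
    forth : E G x y → E H (φ x) (φ y)
    forth e with respects x y e
    ... | inj₂ e′ = e′
    ... | inj₁ φx≡φy with injective x y φx≡φy
    ...   | refl = ⊥-elim (irrG x e)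
    back : E H (φ x) (φ y) → E G x y
    back e′ with realising (φ x) (φ y) e′
    ... | a , b , φa≡φx , φb≡φy , e with injective a x φa≡φx | injective b y φb≡φy
    ...   | refl | refl = e

module Contracted {G H : Graph} (M : Model G H) {u v : V G} (e : E G u v)
                  (φv≡φu : Model.φ M v ≡ Model.φ M u) where
  open Model M
  open Quotient G u v

  G′ : Graph
  G′ = contract G u v e

  φ′ : CV G u v → V H
  φ′ nothing = φ u
  φ′ (just (x , _)) = φ x

  φ′-π : ∀ x → φ′ (π x) ≡ φ x
  φ′-π x with π x | view x
  ... | nothing | at-u refl = refl
  ... | nothing | at-v refl = sym φv≡φu
  ... | just _  | other _ _ = refl

  walk-π : ∀ {h x y} → Walk G (λ z → φ z ≡ h) x y → Walk G′ (λ Z → φ′ Z ≡ h) (π x) (π y)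
  walk-π [] = []
  walk-π (_∷_ {y = y} (exy , φy≡h) w) with π-edge exy
  ... | inj₁ πx≡πy rewrite πx≡πy = walk-π w
  ... | inj₂ ce = (ce , trans (φ′-π y) φy≡h) ∷ walk-π w

  -- Through π, the new vertex behaves like u.
  respects-at-u : ∀ w → φ w ≡ φ u → ∀ y → E G w y → φ u ≡ φ y ⊎ E H (φ u) (φ y)
  respects-at-u w φw≡φu y c = subst (λ h → h ≡ φ y ⊎ E H h (φ y)) φw≡φu (respects w y c)

  respects-to-u : ∀ w → φ w ≡ φ u → ∀ x → E G x w → φ x ≡ φ u ⊎ E H (φ x) (φ u)
  respects-to-u w φw≡φu x c = subst (λ h → φ x ≡ h ⊎ E H (φ x) h) φw≡φu (respects x w c)

  model : Model G′ H
  model = record { φ = φ′ ; onto = onto′ ; respects = respects′ ; connected = connected′ }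
    where
    onto′ : ∀ h → Σ (CV G u v) λ X → φ′ X ≡ h
    onto′ h with onto h
    ... | x , φx≡h = π x , trans (φ′-π x) φx≡h
    respects′ : ∀ X Y → CE G u v X Y → φ′ X ≡ φ′ Y ⊎ E H (φ′ X) (φ′ Y)
    respects′ nothing (just (y , _)) (inj₁ c) = respects-at-u u refl y c
    respects′ nothing (just (y , _)) (inj₂ c) = respects-at-u v φv≡φu y c
    respects′ (just (x , _)) nothing (inj₁ c) = respects-to-u u refl x c
    respects′ (just (x , _)) nothing (inj₂ c) = respects-to-u v φv≡φu x c
    respects′ (just (x , _)) (just (y , _)) c = respects x y c
    connected′ : ∀ X Y → φ′ X ≡ φ′ Y → Walk G′ (λ Z → φ′ Z ≡ φ′ X) X Y
    connected′ X Y φ′X≡φ′Y with π-onto X | π-onto Y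
    ... | x , refl | y , refl =
      subst (λ h → Walk G′ (λ Z → φ′ Z ≡ h) (π x) (π y)) (sym (φ′-π x))
        (walk-π (connected x y (trans (sym (φ′-π x)) (trans φ′X≡φ′Y (φ′-π y)))))

  realising : Irreflexive H → Realising M → Realising model
  realising irrH real h h′ eh with real h h′ eh
  ... | a , b , φa≡h , φb≡h′ , eab with π-edge eab
  ...   | inj₂ ce = π a , π b , trans (φ′-π a) φa≡h , trans (φ′-π b) φb≡h′ , ce
  ...   | inj₁ πa≡πb = ⊥-elim (irrH h (subst (E H h) h′≡h eh))
    where
    h′≡h = trans (sym φb≡h′) (trans (sym (φ′-π b)) (trans (sym (cong φ′ πa≡πb)) (trans (φ′-π a) φa≡h)))

  irreflexive : Irreflexive G → Irreflexive G′
  irreflexive irrG nothing ()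
  irreflexive irrG (just (x , _)) = irrG x

-- A realising model in a finite loopless graph yields a contraction:
-- while φ is not injective, contract an edge inside a fibre.
model-contraction : ∀ {H} → Irreflexive H → ∀ n {G} (xs : List (V G)) →
  (∀ x → x ∈ xs) → length xs ≡ n → Irreflexive G →
  (M : Model G H) → Realising M → ContainsContraction G H
model-contraction {H} irrH n {G} xs complete len irrG M real
  with collision-or-injective (_≟V_ G) (_≟V_ H) (record { elements = xs ; complete = complete }) φ
  where open Model M
... | inj₂ injective = done (injective-model-iso irrG M real injective)
... | inj₁ (x , y , x≢y , φx≡φy) with leave (Model.connected M x y φx≡φy) x≢y
...   | z , e , φz≡φx , z≢x with Quotient.shrink G x z (z≢x ∘ sym) xs complete | n
...     | ys , complete′ , len′ | zero = ⊥-elim (suc≢zero (trans len′ len))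
  where
  suc≢zero : ∀ {k} → suc k ≢ zero
  suc≢zero ()
...     | ys , complete′ , len′ | suc n′ =
  step x z e (model-contraction irrH n′ ys complete′ (suc-injective (trans len′ len))
               (C.irreflexive irrG) C.model (C.realising irrH real))
  where module C = Contracted M e φz≡φx

P5-irreflexive : Irreflexive P5
P5-irreflexive i (inj₁ eq) = 1+n≢n (sym eq)
P5-irreflexive i (inj₂ eq) = 1+n≢n (sym eq)

realising-P5 : ∀ {G} → Symmetric G → (M : Model G P5) →
  (∀ (i : Fin 4) → Σ (V G) λ a → Σ (V G) λ b →
     Model.φ M a ≡ inject₁ i × Model.φ M b ≡ F.suc i × E G a b) →
  Realising M
realising-P5 {G} symG M bridge h h′ (inj₁ h′≡1+h) = up h h′ h′≡1+h
  where
  up : ∀ h h′ → toℕ h′ ≡ suc (toℕ h) →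
       Σ (V G) λ a → Σ (V G) λ b → Model.φ M a ≡ h × Model.φ M b ≡ h′ × E G a b
  up h (F.suc i) eq with bridge i
  ... | a , b , φa , φb , e = a , b , trans φa i≡h , φb , e
    where
    i≡h : inject₁ i ≡ h
    i≡h = toℕ-injective (trans (toℕ-inject₁ i) (suc-injective eq))
realising-P5 {G} symG M bridge h h′ (inj₂ h≡1+h′) with realising-P5 symG M bridge h′ h (inj₁ h≡1+h′)
... | a , b , φa , φb , e = b , a , φb , φa , symG a b e

record Levelling (G : Graph) : Set where
  field
    level     : V G → ℕ
    bounded   : ∀ x → level x ≤ 4
    lipschitz : ∀ x y → E G x y → level y ≤ suc (level x)
    connected : ∀ x y → level x ≡ level y → Walk G (λ z → level z ≡ level x) x y
    bottom    : Σ (V G) λ x → level x ≡ 0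
    top       : Σ (V G) λ x → level x ≡ 4

model-levelling : ∀ {G} → Model G P5 → Levelling G
model-levelling {G} M = record
  { level = level ; bounded = λ x → s≤s⁻¹ (toℕ<n (φ x)) ; lipschitz = lipschitz
  ; connected = λ x y eq → mapWalk (cong toℕ) (connected x y (toℕ-injective eq))
  ; bottom = let x , φx≡0 = onto (# 0) in x , cong toℕ φx≡0
  ; top = let x , φx≡4 = onto (# 4) in x , cong toℕ φx≡4 }
  where
  open Model M
  level : V G → ℕ
  level x = toℕ (φ x)
  lipschitz : ∀ x y → E G x y → level y ≤ suc (level x)
  lipschitz x y e with respects x y e
  ... | inj₁ φx≡φy = m≤n⇒m≤1+n (≤-reflexive (cong toℕ (sym φx≡φy)))
  ... | inj₂ (inj₁ up) = ≤-reflexive up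
  ... | inj₂ (inj₂ down) = m≤n⇒m≤1+n (≤-trans (n≤1+n _) (≤-reflexive (sym down)))

∸-lipschitz : ∀ c {a b} → a ≤ suc b → c ∸ b ≤ suc (c ∸ a)
∸-lipschitz c {a} {b} a≤1+b = m≤n+o⇒m∸n≤o c b (begin
  c                  ≤⟨ m≤n+m∸n c a ⟩
  a + (c ∸ a)        ≤⟨ +-monoˡ-≤ (c ∸ a) a≤1+b ⟩
  suc b + (c ∸ a)    ≡⟨ sym (+-suc b (c ∸ a)) ⟩
  b + suc (c ∸ a)    ∎)
  where open ≤-Reasoning

mirror : ∀ {G} → Symmetric G → Levelling G → Levelling G
mirror {G} symG L = record
  { level = λ x → 4 ∸ level x
  ; bounded = λ x → m∸n≤m 4 (level x)
  ; lipschitz = λ x y e → ∸-lipschitz 4 (lipschitz y x (symG x y e))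
  ; connected = λ x y eq → mapWalk (cong (4 ∸_))
      (connected x y (∸-cancelˡ-≡ (bounded x) (bounded y) eq))
  ; bottom = let x , ℓx≡4 = top in x , cong (4 ∸_) ℓx≡4
  ; top = let x , ℓx≡0 = bottom in x , cong (4 ∸_) ℓx≡0 }
  where open Levelling L

-- Walks of length at most n along a relation R.
data Path {A : Set} (R : A → A → Set) : ℕ → A → A → Set where
  []  : ∀ {n x} → Path R n x x
  _∷_ : ∀ {n x y z} → R x y → Path R n y z → Path R (suc n) x z

module _ {G : Graph} (L : Levelling G) where
  open Levelling L

  path-bound : ∀ {R} → (∀ {x y} → R x y → E G x y) →
               ∀ {n x y} → Path R n x y → level y ≤ n + level x
  path-bound edge {n} {x} [] = m≤n+m (level x) n
  path-bound edge {suc n} {x} (_∷_ {y = y} r p) = begin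
    level _          ≤⟨ path-bound edge p ⟩
    n + level y      ≤⟨ +-monoʳ-≤ n (lipschitz x y (edge r)) ⟩
    n + suc (level x) ≡⟨ +-suc n (level x) ⟩
    suc n + level x  ∎
    where open ≤-Reasoning

  level-neighbour : ∀ {x y} → x ≢ y → level x ≡ level y →
                    Σ (V G) λ z → E G x z × level z ≡ level x
  level-neighbour {x} {y} x≢y ℓx≡ℓy with leave (connected x y ℓx≡ℓy) x≢y
  ... | z , e , ℓz≡ℓx , _ = z , e , ℓz≡ℓx

module Construction (m k : ℕ) (S : Hypergraph m (suc k)) (k≥1 : 1 ≤ k)
                    (nonempty : ∀ j → Nonempty (S j)) (S-last : S (fromℕ k) ≡ ⊤) where

  G : Graph
  G = graphG S

  Ed : GV S → GV S → Set
  Ed = GE S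

  -- N is the index of the last set S_n = Q.
  N : Fin (suc k)
  N = fromℕ k

  ∈N : ∀ i → i ∈ₛ S N
  ∈N i = subst (i ∈ₛ_) (sym S-last) ∈⊤

  -- Since n ≥ 2, every set index has a different one.
  another : ∀ j → Σ (Fin (suc k)) λ j′ → j′ ≢ j
  another j with j F.≟ N
  ... | yes refl = F.zero , 0≢N k≥1
    where
    0≢N : ∀ {k} → 1 ≤ k → F.zero ≢ fromℕ k
    0≢N (s≤s z≤n) ()
  ... | no j≢N = N , j≢N ∘ sym

  data Arc : GV S → GV S → Set where
    qS′  : ∀ {i j} → i ∈ₛ S j → Arc (vq i) (vS' j)
    SS′  : ∀ {j l} → Arc (vS j) (vS' l)
    Q′q  : ∀ {i j p} → Arc (vQ' i j p) (vq i)
    Q′S  : ∀ {i j p} → Arc (vQ' i j p) (vS j)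
    q*u₁ : Arc vq* vu₁
    q*u₂ : Arc vq* vu₂
    q*Q′ : ∀ {i j p} → Arc vq* (vQ' i j p)
    u₁S  : ∀ {j} → Arc vu₁ (vS j)
    u₂S  : ∀ {j} → Arc vu₂ (vS j)
    u₁v  : Arc vu₁ vv
    u₂v  : Arc vu₂ vv
    wS′  : ∀ {j} → Arc vw (vS' j)

  arc-edge : ∀ {x y} → Arc x y → GB S x y
  arc-edge (qS′ i∈Sj) = i∈Sj
  arc-edge SS′  = tt
  arc-edge Q′q  = refl
  arc-edge Q′S  = refl
  arc-edge q*u₁ = tt
  arc-edge q*u₂ = tt
  arc-edge q*Q′ = tt
  arc-edge u₁S  = tt
  arc-edge u₂S  = tt
  arc-edge u₁v  = tt
  arc-edge u₂v  = tt
  arc-edge wS′  = tt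

  qS′N : ∀ i → Arc (vq i) (vS' N)
  qS′N i = qS′ (∈N i)

  Link : GV S → GV S → Set
  Link x y = Arc x y ⊎ Arc y x

  fw : ∀ {x y} → Arc x y → Link x y
  fw = inj₁

  bw : ∀ {x y} → Arc y x → Link x y
  bw = inj₂

  link-edge : ∀ {x y} → Link x y → Ed x y
  link-edge (inj₁ a) = inj₁ (arc-edge a)
  link-edge (inj₂ a) = inj₂ (arc-edge a)

  -- The pairs of vertices at distance four: v–w, v–qᵢ and q*–w.
  data Far : GV S → GV S → Set where
    v-w  : Far vv vw
    v-q  : ∀ i → Far vv (vq i)
    q*-w : Far vq* vw

  data Proximity (x y : GV S) : Set where
    far   : Far x y → Proximity x y
    far′  : Far y x → Proximity x y
    close : Path Link 3 x y → Proximity x y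

  near : ∀ x y → Proximity x y
  near (vq i) (vq i′)       = close (fw (qS′N i) ∷ bw (qS′N i′) ∷ [])
  near (vq i) (vS j)        = close (fw (qS′N i) ∷ bw SS′ ∷ [])
  near (vq i) (vS' j)       = close (fw (qS′N i) ∷ bw (SS′ {N}) ∷ fw SS′ ∷ [])
  near (vq i) (vQ' i′ j p)  = close (fw (qS′N i) ∷ bw (qS′N i′) ∷ bw Q′q ∷ [])
  near (vq i) vq*           = close (bw (Q′q {p = fromWitness (∈N i)}) ∷ bw q*Q′ ∷ [])
  near (vq i) vu₁           = close (fw (qS′N i) ∷ bw (SS′ {N}) ∷ bw u₁S ∷ [])
  near (vq i) vu₂           = close (fw (qS′N i) ∷ bw (SS′ {N}) ∷ bw u₂S ∷ [])
  near (vq i) vv            = far′ (v-q i)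
  near (vq i) vw            = close (fw (qS′N i) ∷ bw wS′ ∷ [])
  near (vS j) (vq i)        = close (fw (SS′ {l = N}) ∷ bw (qS′N i) ∷ [])
  near (vS j) (vS j′)       = close (fw (SS′ {l = N}) ∷ bw SS′ ∷ [])
  near (vS j) (vS' j′)      = close (fw SS′ ∷ [])
  near (vS j) (vQ' i j′ p)  = close (fw (SS′ {l = j′}) ∷ bw SS′ ∷ bw Q′S ∷ [])
  near (vS j) vq*           = close (bw u₁S ∷ bw q*u₁ ∷ [])
  near (vS j) vu₁           = close (bw u₁S ∷ [])
  near (vS j) vu₂           = close (bw u₂S ∷ [])
  near (vS j) vv            = close (bw u₁S ∷ fw u₁v ∷ [])
  near (vS j) vw            = close (fw (SS′ {l = N}) ∷ bw wS′ ∷ [])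
  near (vS' j) (vq i)       = close (bw (SS′ {N}) ∷ fw SS′ ∷ bw (qS′N i) ∷ [])
  near (vS' j) (vS j′)      = close (bw SS′ ∷ [])
  near (vS' j) (vS' j′)     = close (bw (SS′ {N}) ∷ fw SS′ ∷ [])
  near (vS' j) (vQ' i j′ p) = close (bw (SS′ {j′}) ∷ bw Q′S ∷ [])
  near (vS' j) vq*          = close (bw (SS′ {j}) ∷ bw u₁S ∷ bw q*u₁ ∷ [])
  near (vS' j) vu₁          = close (bw (SS′ {N}) ∷ bw u₁S ∷ [])
  near (vS' j) vu₂          = close (bw (SS′ {N}) ∷ bw u₂S ∷ [])
  near (vS' j) vv           = close (bw (SS′ {j}) ∷ bw u₁S ∷ fw u₁v ∷ [])
  near (vS' j) vw           = close (bw wS′ ∷ [])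
  near (vQ' i j p) (vq i′)  = close (fw Q′q ∷ fw (qS′N i) ∷ bw (qS′N i′) ∷ [])
  near (vQ' i j p) (vS j′)  = close (fw Q′q ∷ fw (qS′N i) ∷ bw SS′ ∷ [])
  near (vQ' i j p) (vS' j′) = close (fw Q′S ∷ fw SS′ ∷ [])
  near (vQ' i j p) (vQ' i′ j′ p′) = close (bw q*Q′ ∷ fw q*Q′ ∷ [])
  near (vQ' i j p) vq*      = close (bw q*Q′ ∷ [])
  near (vQ' i j p) vu₁      = close (bw q*Q′ ∷ fw q*u₁ ∷ [])
  near (vQ' i j p) vu₂      = close (bw q*Q′ ∷ fw q*u₂ ∷ [])
  near (vQ' i j p) vv       = close (bw q*Q′ ∷ fw q*u₁ ∷ fw u₁v ∷ [])
  near (vQ' i j p) vw       = close (fw Q′q ∷ fw (qS′N i) ∷ bw wS′ ∷ [])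
  near vq* (vq i)           = close (fw (q*Q′ {p = fromWitness (∈N i)}) ∷ fw Q′q ∷ [])
  near vq* (vS j)           = close (fw q*u₁ ∷ fw u₁S ∷ [])
  near vq* (vS' j)          = close (fw q*u₁ ∷ fw (u₁S {j}) ∷ fw SS′ ∷ [])
  near vq* (vQ' i j p)      = close (fw q*Q′ ∷ [])
  near vq* vq*              = close []
  near vq* vu₁              = close (fw q*u₁ ∷ [])
  near vq* vu₂              = close (fw q*u₂ ∷ [])
  near vq* vv               = close (fw q*u₁ ∷ fw u₁v ∷ [])
  near vq* vw               = far q*-w
  near vu₁ (vq i)           = close (fw (u₁S {N}) ∷ fw SS′ ∷ bw (qS′N i) ∷ [])
  near vu₁ (vS j)           = close (fw u₁S ∷ [])
  near vu₁ (vS' j)          = close (fw (u₁S {N}) ∷ fw SS′ ∷ [])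
  near vu₁ (vQ' i j p)      = close (bw q*u₁ ∷ fw q*Q′ ∷ [])
  near vu₁ vq*              = close (bw q*u₁ ∷ [])
  near vu₁ vu₁              = close []
  near vu₁ vu₂              = close (bw q*u₁ ∷ fw q*u₂ ∷ [])
  near vu₁ vv               = close (fw u₁v ∷ [])
  near vu₁ vw               = close (fw (u₁S {N}) ∷ fw (SS′ {l = N}) ∷ bw wS′ ∷ [])
  near vu₂ (vq i)           = close (fw (u₂S {N}) ∷ fw SS′ ∷ bw (qS′N i) ∷ [])
  near vu₂ (vS j)           = close (fw u₂S ∷ [])
  near vu₂ (vS' j)          = close (fw (u₂S {N}) ∷ fw SS′ ∷ [])
  near vu₂ (vQ' i j p)      = close (bw q*u₂ ∷ fw q*Q′ ∷ [])
  near vu₂ vq*              = close (bw q*u₂ ∷ [])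
  near vu₂ vu₁              = close (bw q*u₂ ∷ fw q*u₁ ∷ [])
  near vu₂ vu₂              = close []
  near vu₂ vv               = close (fw u₂v ∷ [])
  near vu₂ vw               = close (fw (u₂S {N}) ∷ fw (SS′ {l = N}) ∷ bw wS′ ∷ [])
  near vv (vq i)            = far (v-q i)
  near vv (vS j)            = close (bw u₁v ∷ fw u₁S ∷ [])
  near vv (vS' j)           = close (bw u₁v ∷ fw (u₁S {j}) ∷ fw SS′ ∷ [])
  near vv (vQ' i j p)       = close (bw u₁v ∷ bw q*u₁ ∷ fw q*Q′ ∷ [])
  near vv vq*               = close (bw u₁v ∷ bw q*u₁ ∷ [])
  near vv vu₁               = close (bw u₁v ∷ [])
  near vv vu₂               = close (bw u₂v ∷ [])
  near vv vv                = close []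
  near vv vw                = far v-w
  near vw (vq i)            = close (fw (wS′ {N}) ∷ bw (qS′N i) ∷ [])
  near vw (vS j)            = close (fw (wS′ {N}) ∷ bw SS′ ∷ [])
  near vw (vS' j)           = close (fw (wS′ {N}) ∷ bw (SS′ {N}) ∷ fw SS′ ∷ [])
  near vw (vQ' i j p)       = close (fw (wS′ {N}) ∷ bw (qS′N i) ∷ bw Q′q ∷ [])
  near vw vq*               = far′ q*-w
  near vw vu₁               = close (fw (wS′ {N}) ∷ bw (SS′ {N}) ∷ bw u₁S ∷ [])
  near vw vu₂               = close (fw (wS′ {N}) ∷ bw (SS′ {N}) ∷ bw u₂S ∷ [])
  near vw vv                = far′ v-w
  near vw vw                = close []

  symmetric : Symmetric G
  symmetric x y = swap

  arc : ∀ x y → GB S x y → Arc x y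
  arc (vq i) (vS' j) i∈Sj = qS′ i∈Sj
  arc (vS j) (vS' l) _ = SS′
  arc (vQ' i j p) (vq .i) refl = Q′q
  arc (vQ' i j p) (vS .j) refl = Q′S
  arc vq* vu₁ _ = q*u₁
  arc vq* vu₂ _ = q*u₂
  arc vq* (vQ' i j p) _ = q*Q′
  arc vu₁ (vS j) _ = u₁S
  arc vu₂ (vS j) _ = u₂S
  arc vu₁ vv _ = u₁v
  arc vu₂ vv _ = u₂v
  arc vw (vS' j) _ = wS′

  link-of : ∀ {x y} → Ed x y → Link x y
  link-of {x} {y} (inj₁ b) = inj₁ (arc x y b)
  link-of {x} {y} (inj₂ b) = inj₂ (arc y x b)

  loopless : Irreflexive G
  loopless x (inj₁ b) with arc x x b
  ... | ()
  loopless x (inj₂ b) with arc x x b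
  ... | ()

  enumeration : Enumeration (GV S)
  enumeration =
    enum-⊎ (enum-Fin m) (enum-⊎ (enum-Fin (suc k)) (enum-⊎ (enum-Fin (suc k))
      (enum-⊎ (enum-Σ (enum-Σ (enum-Fin m) λ _ → enum-Fin (suc k))
                      λ { (i , j) → enum-T (isYes (i ∈? S j)) })
              (enum-Fin 5))))

  -- Walks may be written link by link and then read as walks of G.
  G♯ : Graph
  G♯ = record { V = GV S ; _≟V_ = GV-≟ S ; E = Link }

  embed : ∀ {P x y} → Walk G♯ P x y → Walk G P x y
  embed [] = []
  embed ((l , p) ∷ w) = (link-edge l , p) ∷ embed w

  module FromColouring (c : Fin m → Bool) (colouring : Is2Colouring S c) where

    colour-level : Bool → Fin 5
    colour-level true  = # 3
    colour-level false = # 2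

    φ : GV S → Fin 5
    φ (vq i)      = colour-level (c i)
    φ (vS _)      = # 2
    φ (vS' _)     = # 3
    φ (vQ' _ _ _) = # 2
    φ vq*         = # 1
    φ vu₁         = # 1
    φ vu₂         = # 1
    φ vv          = # 0
    φ vw          = # 4

    respects-arc : ∀ {x y} → Arc x y → φ x ≡ φ y ⊎ E P5 (φ x) (φ y)
    respects-arc {vq i} (qS′ _) with c i
    ... | true  = inj₁ refl
    ... | false = inj₂ (inj₁ refl)
    respects-arc {vQ' i _ _} Q′q with c i
    ... | true  = inj₂ (inj₁ refl)
    ... | false = inj₁ refl
    respects-arc SS′  = inj₂ (inj₁ refl)
    respects-arc Q′S  = inj₁ refl
    respects-arc q*u₁ = inj₁ refl
    respects-arc q*u₂ = inj₁ refl
    respects-arc q*Q′ = inj₂ (inj₁ refl)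
    respects-arc u₁S  = inj₂ (inj₁ refl)
    respects-arc u₂S  = inj₂ (inj₁ refl)
    respects-arc u₁v  = inj₂ (inj₂ refl)
    respects-arc u₂v  = inj₂ (inj₂ refl)
    respects-arc wS′  = inj₂ (inj₂ refl)

    respects : ∀ x y → Ed x y → φ x ≡ φ y ⊎ E P5 (φ x) (φ y)
    respects x y (inj₁ b) = respects-arc (arc x y b)
    respects x y (inj₂ b) = ⊎-map sym swap (respects-arc (arc y x b))

    hub : Fin 5 → GV S
    hub F.zero = vv
    hub (F.suc F.zero) = vq*
    hub (F.suc (F.suc F.zero)) = vS N
    hub (F.suc (F.suc (F.suc F.zero))) = vS' N
    hub (F.suc (F.suc (F.suc (F.suc F.zero)))) = vw

    φ-hub : ∀ h → φ (hub h) ≡ h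
    φ-hub F.zero = refl
    φ-hub (F.suc F.zero) = refl
    φ-hub (F.suc (F.suc F.zero)) = refl
    φ-hub (F.suc (F.suc (F.suc F.zero))) = refl
    φ-hub (F.suc (F.suc (F.suc (F.suc F.zero)))) = refl

    q-to-hub : ∀ i b → Walk G♯ (λ z → φ z ≡ colour-level b) (vq i) (hub (colour-level b))
    q-to-hub i true  = (fw (qS′N i) , refl) ∷ []
    q-to-hub i false = (bw (Q′q {p = fromWitness (∈N i)}) , refl) ∷ (fw Q′S , refl) ∷ []

    -- Sⱼ reaches S_N through some qᵢ ∈ Sⱼ of colour false.
    S-to-hub : ∀ j → Walk G♯ (λ z → φ z ≡ φ (vS j)) (vS j) (vS N)
    S-to-hub j with proj₂ (colouring j)
    ... | i , i∈Sj , ci≡false =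
      (bw (Q′S {p = fromWitness i∈Sj}) , refl) ∷ (fw Q′q , cong colour-level ci≡false) ∷
      (bw (Q′q {p = fromWitness (∈N i)}) , refl) ∷ (fw Q′S , refl) ∷ []

    -- S′ⱼ reaches S′_N through some qᵢ ∈ Sⱼ of colour true.
    S′-to-hub : ∀ j → Walk G♯ (λ z → φ z ≡ φ (vS' j)) (vS' j) (vS' N)
    S′-to-hub j with proj₁ (colouring j)
    ... | i , i∈Sj , ci≡true = (bw (qS′ i∈Sj) , cong colour-level ci≡true) ∷ (fw (qS′N i) , refl) ∷ []

    to-hub : ∀ x → Walk G♯ (λ z → φ z ≡ φ x) x (hub (φ x))
    to-hub (vq i)      = q-to-hub i (c i)
    to-hub (vS j)      = S-to-hub j
    to-hub (vS' j)     = S′-to-hub j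
    to-hub (vQ' i j p) = (fw Q′S , refl) ∷ S-to-hub j
    to-hub vq*         = []
    to-hub vu₁         = (bw q*u₁ , refl) ∷ []
    to-hub vu₂         = (bw q*u₂ , refl) ∷ []
    to-hub vv          = []
    to-hub vw          = []

    connected : ∀ x y → φ x ≡ φ y → Walk G (λ z → φ z ≡ φ x) x y
    connected x y φx≡φy = embed (to-hub x ++ʷ back)
      where
      back : Walk G♯ (λ z → φ z ≡ φ x) (hub (φ x)) y
      back = subst (λ h → Walk G♯ (λ z → φ z ≡ h) (hub h) y) (sym φx≡φy)
                   (reverseʷ (λ _ _ → swap) refl (to-hub y))

    model : Model G P5
    model = record
      { φ = φ ; onto = λ h → hub h , φ-hub h ; respects = respects ; connected = connected }

    realising : Realising model
    realising = realising-P5 symmetric model bridge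
      where
      bridge : ∀ (i : Fin 4) → Σ (GV S) λ a → Σ (GV S) λ b →
               φ a ≡ F.inject₁ i × φ b ≡ F.suc i × Ed a b
      bridge F.zero = vv , vu₁ , refl , refl , link-edge (bw u₁v)
      bridge (F.suc F.zero) = vu₁ , vS N , refl , refl , link-edge (fw (u₁S {N}))
      bridge (F.suc (F.suc F.zero)) = vS N , vS' N , refl , refl , link-edge (fw (SS′ {N} {N}))
      bridge (F.suc (F.suc (F.suc F.zero))) = vS' N , vw , refl , refl , link-edge (bw (wS′ {N}))

  colouring⇒contraction : Has2Colouring S → ContainsContraction G P5
  colouring⇒contraction (c , colouring) =
    model-contraction P5-irreflexive _ (Enumeration.elements enumeration) (Enumeration.complete enumeration) refl
      loopless model realising
    where open FromColouring c colouring

  module FromLevelling (L : Levelling G) where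
    open Levelling L

    lower : ∀ {x y n} → Link x y → suc n ≤ level x → n ≤ level y
    lower {x} {y} l n<ℓx = s≤s⁻¹ (≤-trans n<ℓx (lipschitz y x (symmetric x y (link-edge l))))

    upper : ∀ {x y n} → Link x y → level x ≤ n → level y ≤ suc n
    upper {x} {y} l ℓx≤n = ≤-trans (lipschitz x y (link-edge l)) (s≤s ℓx≤n)

    exactly : ∀ {x n} → n ≤ level x → level x ≤ n → level x ≡ n
    exactly n≤ℓx ℓx≤n = ≤-antisym ℓx≤n n≤ℓx

    clash : ∀ {A : Set} {x a b} → level x ≡ a → level x ≡ b → a ≢ b → A
    clash ℓx≡a ℓx≡b a≢b = ⊥-elim (a≢b (trans (sym ℓx≡a) ℓx≡b))

    clash≤ : ∀ {A : Set} {x} → 2 ≤ level x → level x ≡ 1 → A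
    clash≤ 2≤ℓx ℓx≡1 with subst (2 ≤_) ℓx≡1 2≤ℓx
    ... | s≤s ()

    S≥2 : 3 ≤ level (vS' N) → ∀ j → 2 ≤ level (vS j)
    S≥2 h j = lower (bw (SS′ {j} {N})) h

    u₁≥1 : 3 ≤ level (vS' N) → 1 ≤ level vu₁
    u₁≥1 h = lower (bw (u₁S {N})) (S≥2 h N)

    u₂≥1 : 3 ≤ level (vS' N) → 1 ≤ level vu₂
    u₂≥1 h = lower (bw (u₂S {N})) (S≥2 h N)

    S′≥3 : level vw ≡ 4 → ∀ j → 3 ≤ level (vS' j)
    S′≥3 h4 j = lower (fw (wS′ {j})) (≤-reflexive (sym h4))

    u₁=1 : level vv ≡ 0 → 3 ≤ level (vS' N) → level vu₁ ≡ 1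
    u₁=1 h0 h = exactly (u₁≥1 h) (upper (bw u₁v) (≤-reflexive h0))

    u₂=1 : level vv ≡ 0 → 3 ≤ level (vS' N) → level vu₂ ≡ 1
    u₂=1 h0 h = exactly (u₂≥1 h) (upper (bw u₂v) (≤-reflexive h0))

    -- Levels v = 0, w = 4 force the layering of the forward direction, and
    -- the level-3 / level-2 elements of Q form a 2-colouring.
    module Bottom-v-top-w (h0 : level vv ≡ 0) (h4 : level vw ≡ 4) where
      S′N≥3 : 3 ≤ level (vS' N)
      S′N≥3 = S′≥3 h4 N

      S=2 : ∀ j → level (vS j) ≡ 2
      S=2 j = exactly (S≥2 S′N≥3 j) (upper (fw (u₁S {j})) (≤-reflexive (u₁=1 h0 S′N≥3)))

      S′=3 : ∀ j → level (vS' j) ≡ 3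
      S′=3 j = exactly (S′≥3 h4 j) (upper (fw (SS′ {j} {j})) (≤-reflexive (S=2 j)))

      -- u₁ and u₂ share level 1, so u₁ has a neighbour on level 1: only q* qualifies.
      q*=1 : level vq* ≡ 1
      q*=1 with level-neighbour L {vu₁} {vu₂} (λ ()) (trans (u₁=1 h0 S′N≥3) (sym (u₂=1 h0 S′N≥3)))
      ... | z , e , ℓz≡ℓu₁ = neighbour (link-of e) (trans ℓz≡ℓu₁ (u₁=1 h0 S′N≥3))
        where
        neighbour : ∀ {z} → Link vu₁ z → level z ≡ 1 → level vq* ≡ 1
        neighbour (inj₁ (u₁S {j})) ℓz≡1 = clash (S=2 j) ℓz≡1 λ ()
        neighbour (inj₁ u₁v)       ℓz≡1 = clash h0 ℓz≡1 λ ()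
        neighbour (inj₂ q*u₁)      ℓz≡1 = ℓz≡1

      Witness : Fin (suc k) → ℕ → Set
      Witness j n = Σ (Fin m) λ i → i ∈ₛ S j × level (vq i) ≡ n

      -- S′ⱼ shares level 3 with another S′ⱼ′; its level-3 neighbour is some qᵢ ∈ Sⱼ.
      witness₃ : ∀ j → Witness j 3
      witness₃ j with another j
      ... | j′ , j′≢j with level-neighbour L {vS' j} {vS' j′} (λ { refl → j′≢j refl })
                             (trans (S′=3 j) (sym (S′=3 j′)))
      ...   | z , e , ℓz≡ℓS′ = neighbour (link-of e) (trans ℓz≡ℓS′ (S′=3 j))
        where
        neighbour : ∀ {z} → Link (vS' j) z → level z ≡ 3 → Witness j 3
        neighbour (inj₂ (qS′ {i} i∈Sj)) ℓz≡3 = i , i∈Sj , ℓz≡3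
        neighbour (inj₂ (SS′ {l}))      ℓz≡3 = clash (S=2 l) ℓz≡3 λ ()
        neighbour (inj₂ wS′)            ℓz≡3 = clash h4 ℓz≡3 λ ()

      Tube : Fin (suc k) → GV S → Set
      Tube j (vS l)      = l ≡ j
      Tube j (vQ' _ l _) = l ≡ j
      Tube j _           = ⊥

      tube? : ∀ j x → Dec (Tube j x)
      tube? j (vS l)      = l F.≟ j
      tube? j (vQ' _ l _) = l F.≟ j
      tube? j (vq _)      = no λ ()
      tube? j (vS' _)     = no λ ()
      tube? j vq*         = no λ ()
      tube? j vu₁         = no λ ()
      tube? j vu₂         = no λ ()
      tube? j vv          = no λ ()
      tube? j vw          = no λ ()

      boundary : ∀ j {a b} → Tube j a → ¬ Tube j b → Link a b → level b ≡ 2 → Witness j 2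
      boundary j _    _   (inj₁ (SS′ {l = l})) ℓb≡2 = clash (S′=3 l) ℓb≡2 λ ()
      boundary j _    _   (inj₂ u₁S)           ℓb≡2 = clash (u₁=1 h0 S′N≥3) ℓb≡2 λ ()
      boundary j _    _   (inj₂ u₂S)           ℓb≡2 = clash (u₂=1 h0 S′N≥3) ℓb≡2 λ ()
      boundary j refl b∉T (inj₂ Q′S)           ℓb≡2 = ⊥-elim (b∉T refl)
      boundary j refl _   (inj₁ (Q′q {i} {p = p})) ℓb≡2 = i , toWitness p , ℓb≡2
      boundary j refl b∉T (inj₁ Q′S)           ℓb≡2 = ⊥-elim (b∉T refl)
      boundary j _    _   (inj₂ q*Q′)          ℓb≡2 = clash q*=1 ℓb≡2 λ ()

      -- Sⱼ shares level 2 with another Sⱼ′, so a level-2 walk leaves the tube of Sⱼ.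
      witness₂ : ∀ j → Witness j 2
      witness₂ j with another j
      ... | j′ , j′≢j with exit (tube? j) (connected (vS j) (vS j′) (trans (S=2 j) (sym (S=2 j′)))) refl j′≢j
      ...   | a , b , a∈T , b∉T , e , ℓb≡ℓS = boundary j a∈T b∉T (link-of e) (trans ℓb≡ℓS (S=2 j))

      colouring : Has2Colouring S
      colouring = c , λ j →
        (let i , i∈Sj , ℓ≡3 = witness₃ j in i , i∈Sj , on-level-3 i ℓ≡3) ,
        (let i , i∈Sj , ℓ≡2 = witness₂ j in i , i∈Sj , on-level-2 i ℓ≡2)
        where
        c : Fin m → Bool
        c i = isYes (level (vq i) ≟ 3)
        on-level-3 : ∀ i → level (vq i) ≡ 3 → c i ≡ true
        on-level-3 i ℓ≡3 rewrite ℓ≡3 = refl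
        on-level-2 : ∀ i → level (vq i) ≡ 2 → c i ≡ false
        on-level-2 i ℓ≡2 rewrite ℓ≡2 = refl

    -- Levels v = 0, qᵢ = 4 are impossible: u₁ would be alone on level 1.
    bottom-v-top-q : ∀ i → level vv ≡ 0 → level (vq i) ≡ 4 → ⊥
    bottom-v-top-q i h0 h4 = isolated
      where
      S′N≥3 : 3 ≤ level (vS' N)
      S′N≥3 = lower (fw (qS′N i)) (≤-reflexive (sym h4))
      q*≥2 : 2 ≤ level vq*
      q*≥2 = lower (bw q*Q′) (lower (bw (Q′q {p = fromWitness (∈N i)})) (≤-reflexive (sym h4)))
      neighbour : ∀ {z} → Link vu₁ z → level z ≡ 1 → ⊥
      neighbour (inj₁ (u₁S {j})) ℓz≡1 = clash≤ (S≥2 S′N≥3 j) ℓz≡1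
      neighbour (inj₁ u₁v)       ℓz≡1 = clash h0 ℓz≡1 λ ()
      neighbour (inj₂ q*u₁)      ℓz≡1 = clash≤ q*≥2 ℓz≡1
      isolated : ⊥
      isolated with level-neighbour L {vu₁} {vu₂} (λ ()) (trans (u₁=1 h0 S′N≥3) (sym (u₂=1 h0 S′N≥3)))
      ... | z , e , ℓz≡ℓu₁ = neighbour (link-of e) (trans ℓz≡ℓu₁ (u₁=1 h0 S′N≥3))

    -- Levels q* = 0, w = 4 are impossible: q^i_N would be alone on level 1.
    bottom-q*-top-w : level vq* ≡ 0 → level vw ≡ 4 → ⊥
    bottom-q*-top-w h0 h4 with nonempty N
    ... | i , i∈SN = isolated
      where
      S′N≥3 : 3 ≤ level (vS' N)
      S′N≥3 = S′≥3 h4 N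
      u₁≡1 : level vu₁ ≡ 1
      u₁≡1 = exactly (u₁≥1 S′N≥3) (upper (fw q*u₁) (≤-reflexive h0))
      Q : GV S
      Q = vQ' i N (fromWitness i∈SN)
      Q≡1 : level Q ≡ 1
      Q≡1 = exactly (lower (bw Q′S) (S≥2 S′N≥3 N)) (upper (fw q*Q′) (≤-reflexive h0))
      neighbour : ∀ {z} → Link Q z → level z ≡ 1 → ⊥
      neighbour (inj₁ Q′q)  ℓz≡1 = clash≤ (lower (bw (qS′N i)) S′N≥3) ℓz≡1
      neighbour (inj₁ Q′S)  ℓz≡1 = clash≤ (S≥2 S′N≥3 N) ℓz≡1
      neighbour (inj₂ q*Q′) ℓz≡1 = clash h0 ℓz≡1 λ ()
      isolated : ⊥
      isolated with level-neighbour L {Q} {vu₁} (λ ()) (trans Q≡1 (sym u₁≡1))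
      ... | z , e , ℓz≡ℓQ = neighbour (link-of e) (trans ℓz≡ℓQ Q≡1)

    far-colouring : ∀ {x y} → Far x y → level x ≡ 0 → level y ≡ 4 → Has2Colouring S
    far-colouring v-w     h0 h4 = Bottom-v-top-w.colouring h0 h4
    far-colouring (v-q i) h0 h4 = ⊥-elim (bottom-v-top-q i h0 h4)
    far-colouring q*-w    h0 h4 = ⊥-elim (bottom-q*-top-w h0 h4)

  -- The bottom and top of a levelling are four apart, so they form a far pair.
  FarPair : Levelling G → ℕ → ℕ → Set
  FarPair L a b = Σ (GV S) λ x → Σ (GV S) λ y → Far x y × level x ≡ a × level y ≡ b
    where open Levelling L

  far-ends : ∀ L → FarPair L 0 4 ⊎ FarPair L 4 0
  far-ends L with bottom | top
    where open Levelling L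
  ... | x , ℓx≡0 | y , ℓy≡4 with near x y
  ...   | far x↔y   = inj₁ (x , y , x↔y , ℓx≡0 , ℓy≡4)
  ...   | far′ y↔x  = inj₂ (y , x , y↔x , ℓy≡4 , ℓx≡0)
  ...   | close path = ⊥-elim (4≰3 (subst₂ (λ a b → b ≤ 3 + a) ℓx≡0 ℓy≡4
                                          (path-bound L link-edge path)))
    where
    4≰3 : ¬ 4 ≤ 3
    4≰3 (s≤s (s≤s (s≤s ())))

  levelling⇒colouring : Levelling G → Has2Colouring S
  levelling⇒colouring L with far-ends L
  ... | inj₁ (x , y , x↔y , ℓx≡0 , ℓy≡4) = FromLevelling.far-colouring L x↔y ℓx≡0 ℓy≡4
  ... | inj₂ (x , y , x↔y , ℓx≡4 , ℓy≡0) =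
    FromLevelling.far-colouring (mirror symmetric L) x↔y (cong (4 ∸_) ℓx≡4) (cong (4 ∸_) ℓy≡0)

  contraction⇒colouring : ContainsContraction G P5 → Has2Colouring S
  contraction⇒colouring = levelling⇒colouring ∘ model-levelling ∘ contraction-model symmetric

lemma3 : (m k : ℕ) (S : Hypergraph m (suc k)) →
    1 ≤ k →
    (∀ j → Nonempty (S j)) →
    S (fromℕ k) ≡ ⊤ →
    Has2Colouring S ⇔ ContainsContraction (graphG S) P5
lemma3 m k S k≥1 nonempty S-last = mk⇔ colouring⇒contraction contraction⇒colouring
  where open Construction m k S k≥1 nonempty S-last
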